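{- For any positive integers $n, i_1,\ldots,i_n$, with $N:=i_1+\cdots+i_n$, we have $$\Omega'(i_1,\ldots,i_n)=\frac{1}{2(N+1)}\sum_{k=0}^{n}\Omega'(i_1,\ldots,i_{k-1},\,i_k-1)\;\Omega'(i_{k+1}-1,\,i_{k+2},\ldots,i_n),$$ where for $k=0$ the first factor has the empty argument list (so equals $1$) and for $k=n$ the second factor has the empty argument list (so equals $1$).
   Context: A permutation $\tau$ of $\{0,\ldots,M\}$ is said to increase (resp. decrease) on a set $\{p,\ldots,q\}\subseteq\{0,\ldots,M\}$ if $\tau(j)<\tau(j+1)$ (resp. $\tau(j)>\tau(j+1)$) for every $j=p,\ldots,q-1$ (vacuous when $p=q$). For a finite sequence $a_1,\ldots,a_m$ of nonnegative integers ($m\ge1$), put $M:=a_1+\cdots+a_m$, $t_0:=0$, $t_k:=a_1+\cdots+a_k$. Then $\Omega(a_1,\ldots,a_m)$ denotes the number of permutations of $\{0,\ldots,M\}$ which, for every $k=1,\ldots,m$, increase on $\{t_{k-1},\ldots,t_k\}$ if $k$ is odd and decrease on $\{t_{k-1},\ldots,t_k\}$ if $k$ is even (arguments alternately prescribe increasing and decreasing run lengths, starting with increasing). By convention $\Omega$ with no arguments equals $1$. Further, $\Omega'(a_1,\ldots,a_m):=\Omega(a_1,\ldots,a_m)/(a_1+\cdots+a_m+1)!$, and $\Omega'()=1$. -}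

module Defs where

open import Data.Nat using (ℕ; zero; suc; _+_; _*_; _∸_; _<_; _>_; _!; _<?_)
open import Data.Nat.Properties using (_!≢0; _≟_)
open import Data.List using (List; []; _∷_; _++_; replicate; map; concatMap; upTo; filter; length; foldr; take; drop)
open import Data.List.Relation.Unary.Unique.DecPropositional _≟_ using (Unique; unique?)
open import Data.Nat.ListAction using (sum)
open import Data.Product using (_×_)
open import Data.Unit using (⊤; tt)
open import Data.Empty using (⊥)
open import Relation.Nullary using (Dec; yes; no)
open import Relation.Nullary.Decidable using (_×-dec_)
open import Data.Integer using (+_)
open import Data.Rational as ℚ using (ℚ; _/_; 0ℚ)

data Dir : Set where
  up down : Dir

flipDir : Dir → Dir
flipDir up = down
flipDir down = up

-- dirsFrom d (a₁ ∷ … ∷ aₘ): block k of length aₖ, direction alternating starting from d.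
-- Entry j of the result is the prescribed direction between τ(j) and τ(j+1).
dirsFrom : Dir → List ℕ → List Dir
dirsFrom d [] = []
dirsFrom d (a ∷ as) = replicate a d ++ dirsFrom (flipDir d) as

runDirs : List ℕ → List Dir
runDirs = dirsFrom up

Follows : List Dir → List ℕ → Set
Follows [] (x ∷ []) = ⊤
Follows (up ∷ ds) (x ∷ y ∷ xs) = (x < y) × Follows ds (y ∷ xs)
Follows (down ∷ ds) (x ∷ y ∷ xs) = (x > y) × Follows ds (y ∷ xs)
Follows [] [] = ⊥
Follows [] (x ∷ y ∷ xs) = ⊥
Follows (d ∷ ds) [] = ⊥
Follows (d ∷ ds) (x ∷ []) = ⊥

follows? : (ds : List Dir) (xs : List ℕ) → Dec (Follows ds xs)
follows? [] [] = no (λ ())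
follows? [] (x ∷ []) = yes tt
follows? [] (x ∷ y ∷ xs) = no (λ ())
follows? (up ∷ ds) [] = no (λ ())
follows? (down ∷ ds) [] = no (λ ())
follows? (up ∷ ds) (x ∷ []) = no (λ ())
follows? (down ∷ ds) (x ∷ []) = no (λ ())
follows? (up ∷ ds) (x ∷ y ∷ xs) = (x <? y) ×-dec follows? ds (y ∷ xs)
follows? (down ∷ ds) (x ∷ y ∷ xs) = (y <? x) ×-dec follows? ds (y ∷ xs)

lists : ℕ → ℕ → List (List ℕ)
lists zero k = [] ∷ []
lists (suc n) k = concatMap (λ x → map (x ∷_) (lists n k)) (upTo k)

-- Permutations of {0,…,M}, as lists (τ(0),…,τ(M)): the duplicate-free lists
-- of length M+1 with entries in {0,…,M}.
perms : ℕ → List (List ℕ)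
perms M = filter unique? (lists (suc M) (suc M))

-- Ω(a₁,…,aₘ): number of permutations of {0,…,M}, M = a₁+⋯+aₘ, increasing on
-- {t_{k-1},…,t_k} for odd k and decreasing there for even k.
Ω : List ℕ → ℕ
Ω as = length (filter (follows? (runDirs as)) (perms (sum as)))

Ω′ : List ℕ → ℚ
Ω′ as = ((+ Ω as) / (suc (sum as) !)) {{suc (sum as) !≢0}}

decLast : List ℕ → List ℕ
decLast [] = []
decLast (x ∷ []) = x ∸ 1 ∷ []
decLast (x ∷ y ∷ xs) = x ∷ decLast (y ∷ xs)

decHead : List ℕ → List ℕ
decHead [] = []
decHead (x ∷ xs) = x ∸ 1 ∷ xs

sumℚ : List ℚ → ℚ
sumℚ = foldr ℚ._+_ 0ℚ

module Submission where

-- Clearing denominators this is the identity over ℕ (twice-Ω), with t_k = i₁+⋯+i_k,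
--   2 Ω(i₁,…,iₙ) = Σ_k C(N, t_k) Ω(i₁,…,i_k − 1) Ω(i_{k+1} − 1,…,iₙ),
-- which counts every permutation twice: by the position of its maximum and by the
-- position of its minimum.  Extremes can only sit at run boundaries t_k, each boundary
-- holding exactly one kind (peaks the maximum, valleys the minimum).  To make this
-- count exact we work with constraint words over {asc, desc, free}.  Deleting the
-- maximum at position p of a permutation fitting a word leaves one fitting the word
-- with the two steps around p merged into a free step (count-rec); across a free step
-- the count factorises with a binomial coefficient (free-split, by induction using the
-- same recursion); complementing the values exchanges maximum and minimum
-- (count-opposite).

open import Defs
open import Data.Bool using (Bool; true; false; _∧_; T)
open import Data.Bool.Properties using (T-∧)
open import Data.Empty using (⊥; ⊥-elim)
open import Data.Unit using (⊤; tt)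
open import Data.Product using (_×_; _,_; proj₁; proj₂)
open import Data.Product.Function.NonDependent.Propositional using (_×-⇔_)
open import Data.Sum using (inj₁; inj₂)
open import Function using (_∘_; id)
open import Function.Bundles using (_⇔_; mk⇔; Equivalence)
open import Function.Properties.Equivalence using () renaming (refl to ⇔-refl)
open import Relation.Nullary using (¬_; Dec; yes; no; contradiction)
open import Relation.Nullary.Decidable using (_×-dec_)
open import Relation.Unary using (Decidable)
open import Relation.Binary.PropositionalEquality

open import Data.Nat using (ℕ; zero; suc; _+_; _*_; _∸_; _<_; _≤_; z≤n; s≤s; _<?_; _≤?_; _!; NonZero)
import Data.Nat.Properties as ℕ
open import Data.Nat.Properties using (_!≢0; _!*_!≢0)
open import Data.Nat.Combinatorics using (_C_; nCn≡1; nCk+nC[k+1]≡[n+1]C[k+1]; nCk≡n!/k![n-k]!; k![n∸k]!∣n!)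
open import Data.Nat.DivMod using (m/n*n≡m) renaming (_/_ to _div_)
open import Data.Nat.ListAction using (sum)
open import Data.Nat.ListAction.Properties using (sum-++)
open import Data.Nat.Tactic.RingSolver using (solve-∀)
open import Algebra.Properties.CommutativeSemigroup ℕ.+-commutativeSemigroup
  using () renaming (interchange to +-interchange)
open import Data.Integer as ℤ using (+_)
import Data.Integer.Properties as ℤ
open import Data.Integer.Tactic.RingSolver using () renaming (solve-∀ to solveℤ)
open import Data.Rational as ℚ using (ℚ; _/_; toℚᵘ; fromℚᵘ)
import Data.Rational.Properties as ℚ
open import Data.Rational.Unnormalised as ℚᵘ using (mkℚᵘ; *≡*)
import Data.Rational.Unnormalised.Properties as ℚᵘ

open import Data.List using (List; []; _∷_; _++_; map; upTo; length; filter; concat; applyUpTo; take; drop; replicate)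
import Data.List.Properties as List
open import Data.List.Relation.Unary.All as All using (All; []; _∷_)
import Data.List.Relation.Unary.All.Properties as All
open import Data.List.Relation.Unary.AllPairs as AllPairs using (AllPairs; []; _∷_)
import Data.List.Relation.Unary.AllPairs.Properties as AllPairs
open import Data.List.Relation.Unary.Any using (here; there)
open import Data.List.Relation.Unary.Unique.Propositional using (Unique)
import Data.List.Relation.Unary.Unique.Propositional.Properties as Unique
import Data.List.Relation.Unary.Unique.DecPropositional as DecUnique
open import Data.List.Membership.Propositional using (_∈_; _∉_; find; lose)
open import Data.List.Membership.Propositional.Properties
open import Data.List.Membership.Propositional.Properties.WithK using (unique∧set⇒bag)
open import Data.List.Membership.DecPropositional ℕ._≟_ using (_∈?_)
open import Data.List.Relation.Binary.BagAndSetEquality using (∼bag⇒↭)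
open import Data.List.Relation.Binary.Disjoint.Propositional using (Disjoint)
open import Data.List.Relation.Binary.Permutation.Propositional using (_↭_; ↭-sym; ↭-refl; ↭-trans; prep; swap; ↭⇒↭ₛ)
open import Data.List.Relation.Binary.Permutation.Propositional.Properties using (↭-length; All-resp-↭; shift)
open import Data.List.Relation.Binary.Permutation.Setoid.Properties (setoid ℕ) using (Unique-resp-↭)

∑< : ℕ → (ℕ → ℕ) → ℕ
∑< m g = sum (applyUpTo g m)

syntax ∑< m (λ p → e) = ∑[ p < m ] e

∑-cong : ∀ m {f g : ℕ → ℕ} → (∀ p → p < m → f p ≡ g p) → ∑< m f ≡ ∑< m g
∑-cong zero    f≗g = refl
∑-cong (suc m) f≗g = cong₂ _+_ (f≗g 0 (s≤s z≤n)) (∑-cong m (λ p p<m → f≗g (suc p) (s≤s p<m)))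

∑-scale : ∀ m c g → ∑[ p < m ] (c * g p) ≡ c * ∑< m g
∑-scale zero    c g = sym (ℕ.*-zeroʳ c)
∑-scale (suc m) c g = begin
  c * g 0 + ∑[ p < m ] (c * g (suc p)) ≡⟨ cong (_+_ (c * g 0)) (∑-scale m c (g ∘ suc)) ⟩
  c * g 0 + c * ∑< m (g ∘ suc)         ≡⟨ ℕ.*-distribˡ-+ c (g 0) _ ⟨
  c * ∑< (suc m) g                     ∎
  where open ≡-Reasoning

∑-zero : ∀ m g → (∀ p → p < m → g p ≡ 0) → ∑< m g ≡ 0
∑-zero m g g≡0 = trans (∑-cong m (λ p p<m → trans (g≡0 p p<m) (sym (ℕ.*-zeroˡ 1))))
                       (∑-scale m 0 (λ _ → 1))

∑-+ : ∀ m f g → ∑[ p < m ] (f p + g p) ≡ ∑< m f + ∑< m g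
∑-+ zero    f g = refl
∑-+ (suc m) f g = begin
  (f 0 + g 0) + ∑[ p < m ] (f (suc p) + g (suc p)) ≡⟨ cong (_+_ (f 0 + g 0)) (∑-+ m (f ∘ suc) (g ∘ suc)) ⟩
  (f 0 + g 0) + (∑< m (f ∘ suc) + ∑< m (g ∘ suc))  ≡⟨ +-interchange (f 0) (g 0) _ _ ⟩
  ∑< (suc m) f + ∑< (suc m) g                      ∎
  where open ≡-Reasoning

∑-split : ∀ a b g → ∑< (a + b) g ≡ ∑< a g + ∑[ q < b ] g (a + q)
∑-split zero    b g = refl
∑-split (suc a) b g = trans (cong (_+_ (g 0)) (∑-split a b (g ∘ suc))) (sym (ℕ.+-assoc (g 0) _ _))

length-by-members : {A : Set} {xs ys : List A} → Unique xs → Unique ys →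
  (∀ {z} → z ∈ xs → z ∈ ys) → (∀ {z} → z ∈ ys → z ∈ xs) → length xs ≡ length ys
length-by-members ux uy to from = ↭-length (∼bag⇒↭ (unique∧set⇒bag ux uy (mk⇔ to from)))

module _ {A : Set} {P Q : A → Set} (P? : Decidable P) (Q? : Decidable Q) where

  count-cong : ∀ {xs} → Unique xs → (∀ {x} → x ∈ xs → P x → Q x) → (∀ {x} → x ∈ xs → Q x → P x) →
    length (filter P? xs) ≡ length (filter Q? xs)
  count-cong u P⇒Q Q⇒P = length-by-members (Unique.filter⁺ P? u) (Unique.filter⁺ Q? u)
    (λ x∈ → let x∈xs , px = ∈-filter⁻ P? x∈ in ∈-filter⁺ Q? x∈xs (P⇒Q x∈xs px))
    (λ x∈ → let x∈xs , qx = ∈-filter⁻ Q? x∈ in ∈-filter⁺ P? x∈xs (Q⇒P x∈xs qx))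

count-none : {A : Set} {P : A → Set} (P? : Decidable P) {xs : List A} →
  (∀ {x} → x ∈ xs → ¬ P x) → length (filter P? xs) ≡ 0
count-none P? ¬P = cong length (List.filter-none P? (All.tabulate ¬P))

length-concat : {A : Set} (xss : List (List A)) → length (concat xss) ≡ sum (map length xss)
length-concat []         = refl
length-concat (xs ∷ xss) = trans (List.length-++ xs) (cong (_+_ (length xs)) (length-concat xss))

record IsPerm (n : ℕ) (τ : List ℕ) : Set where
  constructor isPerm
  field
    length≡  : length τ ≡ suc n
    bounded  : All (_< suc n) τ
    distinct : Unique τ

lists-∈⁻ : ∀ n k {xs} → xs ∈ lists n k → length xs ≡ n × All (_< k) xs
lists-∈⁻ zero    k (here refl) = refl , []
lists-∈⁻ (suc n) k xs∈
  with x , x∈ , xs∈′ ← find (∈-concatMap⁻ (λ x → map (x ∷_) (lists n k)) {xs = upTo k} xs∈)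
  with ys , ys∈ , refl ← ∈-map⁻ (x ∷_) xs∈′
  with len , bnd ← lists-∈⁻ n k ys∈
  = cong suc len , ∈-upTo⁻ x∈ ∷ bnd

lists-∈⁺ : ∀ n k {xs} → length xs ≡ n → All (_< k) xs → xs ∈ lists n k
lists-∈⁺ zero    k {[]}     _   _           = here refl
lists-∈⁺ (suc n) k {x ∷ xs} len (x<k ∷ bnd) =
  ∈-concatMap⁺ (λ y → map (y ∷_) (lists n k))
    (lose (∈-upTo⁺ x<k) (∈-map⁺ (x ∷_) (lists-∈⁺ n k (ℕ.suc-injective len) bnd)))

lists-unique : ∀ n k → Unique (lists n k)
lists-unique zero    k = [] ∷ []
lists-unique (suc n) k = Unique.concat⁺
  (All.map⁺ (All.tabulate (λ _ → Unique.map⁺ List.∷-injectiveʳ (lists-unique n k))))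
  (AllPairs.map⁺ (AllPairs.map heads-differ (Unique.upTo⁺ k)))
  where
  heads-differ : ∀ {x y} → x ≢ y → Disjoint (map (x ∷_) (lists n k)) (map (y ∷_) (lists n k))
  heads-differ x≢y (v∈ , v∈′) with ∈-map⁻ _ v∈ | ∈-map⁻ _ v∈′
  ... | _ , _ , refl | _ , _ , refl = x≢y refl

∈perms⁻ : ∀ n {τ} → τ ∈ perms n → IsPerm n τ
∈perms⁻ n τ∈ = let τ∈lists , u = ∈-filter⁻ (DecUnique.unique? ℕ._≟_) τ∈
                   len , bnd  = lists-∈⁻ (suc n) (suc n) τ∈lists
               in isPerm len bnd u

∈perms⁺ : ∀ n {τ} → IsPerm n τ → τ ∈ perms n
∈perms⁺ n (isPerm len bnd u) = ∈-filter⁺ (DecUnique.unique? ℕ._≟_) (lists-∈⁺ (suc n) (suc n) len bnd) u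

perms-unique : ∀ n → Unique (perms n)
perms-unique n = Unique.filter⁺ _ (lists-unique (suc n) (suc n))

unique-length≤ : ∀ k {xs} → Unique xs → All (_< k) xs → length xs ≤ k
unique-length≤ k {xs} u bnd = begin
  length xs                         ≡⟨ length-by-members u (Unique.filter⁺ (_∈? xs) (Unique.upTo⁺ k)) to from ⟩
  length (filter (_∈? xs) (upTo k)) ≤⟨ List.length-filter (_∈? xs) (upTo k) ⟩
  length (upTo k)                   ≡⟨ List.length-applyUpTo (λ i → i) k ⟩
  k                                 ∎
  where
  open ℕ.≤-Reasoning
  to : ∀ {z} → z ∈ xs → z ∈ filter (_∈? xs) (upTo k)
  to z∈ = ∈-filter⁺ (_∈? xs) (∈-upTo⁺ (All.lookup bnd z∈)) z∈
  from : ∀ {z} → z ∈ filter (_∈? xs) (upTo k) → z ∈ xs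
  from z∈ = proj₂ (∈-filter⁻ (_∈? xs) {xs = upTo k} z∈)

max∈perm : ∀ n {τ} → IsPerm n τ → n ∈ τ
max∈perm n {τ} (isPerm len bnd u) with n ∈? τ
... | yes n∈τ = n∈τ
... | no  n∉τ = ⊥-elim (ℕ.<-irrefl refl (begin-strict
  n          <⟨ ℕ.n<1+n n ⟩
  suc n      ≡⟨ len ⟨
  length τ   ≤⟨ unique-length≤ n u (All.tabulate below-n) ⟩
  n          ∎))
  where
  open ℕ.≤-Reasoning
  below-n : ∀ {x} → x ∈ τ → x < n
  below-n {x} x∈ = ℕ.≤∧≢⇒< (ℕ.≤-pred (All.lookup bnd x∈)) (λ { refl → n∉τ x∈ })

unique-resp-↭ : ∀ {xs ys : List ℕ} → xs ↭ ys → Unique xs → Unique ys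
unique-resp-↭ xs↭ys = Unique-resp-↭ (↭⇒↭ₛ xs↭ys)

module _ {n : ℕ} {τ σ : List ℕ} (τ↭ : τ ↭ suc n ∷ σ) where

  perm-without-max : IsPerm (suc n) τ → IsPerm n σ
  perm-without-max (isPerm len bnd u) with unique-resp-↭ τ↭ u | All-resp-↭ τ↭ bnd
  ... | max∉σ ∷ uσ | _ ∷ bndσ =
    isPerm (ℕ.suc-injective (trans (sym (↭-length τ↭)) len))
           (All.tabulate (λ x∈ → ℕ.≤∧≢⇒< (ℕ.≤-pred (All.lookup bndσ x∈)) (≢-sym (All.lookup max∉σ x∈))))
           uσ

  perm-with-max : IsPerm n σ → IsPerm (suc n) τ
  perm-with-max (isPerm len bnd u) =
    isPerm (trans (↭-length τ↭) (cong suc len))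
           (All-resp-↭ (↭-sym τ↭) (ℕ.≤-refl ∷ All.map ℕ.m<n⇒m<1+n bnd))
           (unique-resp-↭ (↭-sym τ↭) (All.map (λ x<max → ≢-sym (ℕ.<⇒≢ x<max)) bnd ∷ u))

-- ins p m σ inserts m at position p of σ (at the end when p ≥ length σ).
ins : ℕ → ℕ → List ℕ → List ℕ
ins zero    m σ       = m ∷ σ
ins (suc p) m []      = m ∷ []
ins (suc p) m (x ∷ σ) = x ∷ ins p m σ

ins-↭ : ∀ p m σ → ins p m σ ↭ m ∷ σ
ins-↭ zero    m σ       = ↭-refl
ins-↭ (suc p) m []      = ↭-refl
ins-↭ (suc p) m (x ∷ σ) = ↭-trans (prep x (ins-↭ p m σ)) (swap x m ↭-refl)

ins-split : ∀ (L : List ℕ) R m → ins (length L) m (L ++ R) ≡ L ++ m ∷ R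
ins-split []      R m = refl
ins-split (x ∷ L) R m = cong (x ∷_) (ins-split L R m)

ins-nonempty : ∀ p m σ → ins p m σ ≢ []
ins-nonempty zero    m σ       ()
ins-nonempty (suc p) m []      ()
ins-nonempty (suc p) m (x ∷ σ) ()

ins-injective : ∀ p m {σ σ′} → ins p m σ ≡ ins p m σ′ → σ ≡ σ′
ins-injective zero    m refl = refl
ins-injective (suc p) m {[]}    {[]}     eq = refl
ins-injective (suc p) m {[]}    {x ∷ σ′} eq = ⊥-elim (ins-nonempty p m σ′ (sym (List.∷-injectiveʳ eq)))
ins-injective (suc p) m {x ∷ σ} {[]}     eq = ⊥-elim (ins-nonempty p m σ (List.∷-injectiveʳ eq))
ins-injective (suc p) m {x ∷ σ} {y ∷ σ′} eq with List.∷-injective eq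
... | refl , eq′ = cong (x ∷_) (ins-injective p m eq′)

ins-position : ∀ {p p′ m σ σ′} → m ∉ σ → m ∉ σ′ → p ≤ length σ → p′ ≤ length σ′ →
  ins p m σ ≡ ins p′ m σ′ → p ≡ p′
ins-position {zero}  {zero}              _   _    _       _        _  = refl
ins-position {zero}  {suc p′} {σ′ = y ∷ σ′} _ m∉σ′ _     _       refl = ⊥-elim (m∉σ′ (here refl))
ins-position {suc p} {zero}   {σ = x ∷ σ}   m∉σ _ _       _       refl = ⊥-elim (m∉σ (here refl))
ins-position {suc p} {suc p′} {σ = x ∷ σ} {y ∷ σ′} m∉σ m∉σ′ (s≤s p≤) (s≤s p′≤) eq with List.∷-injective eq
... | refl , eq′ = cong suc (ins-position (m∉σ ∘ there) (m∉σ′ ∘ there) p≤ p′≤ eq′)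

-- Counting permutations of {0,…,n+1} with a decidable property Q according to
-- the position p ∈ {0,…,n+1} of their maximum m = n+1: removing m is a bijection
-- onto the permutations σ of {0,…,n} with Q (ins p m σ).
module MaxPosition {Q : List ℕ → Set} (Q? : Decidable Q) (n : ℕ) where

  m : ℕ
  m = suc n

  Q-at : (p : ℕ) → Decidable (λ σ → Q (ins p m σ))
  Q-at p σ = Q? (ins p m σ)

  block : ℕ → List (List ℕ)
  block p = map (ins p m) (filter (Q-at p) (perms n))

  blocks : List (List ℕ)
  blocks = concat (applyUpTo block (suc m))

  blocks-unique : Unique blocks
  blocks-unique = Unique.concat⁺
    (All.applyUpTo⁺₂ block (suc m) (λ p → Unique.map⁺ (ins-injective p m) (Unique.filter⁺ (Q-at p) (perms-unique n))))
    (AllPairs.applyUpTo⁺₁ block (suc m) disjoint)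
    where
    disjoint : ∀ {i j} → i < j → j < suc m → Disjoint (block i) (block j)
    disjoint {i} {j} i<j j<m+1 (τ∈i , τ∈j)
      with σ , σ∈ , refl ← ∈-map⁻ (ins i m) τ∈i
      with σ′ , σ′∈ , eq ← ∈-map⁻ (ins j m) τ∈j
      = ℕ.<⇒≢ i<j (ins-position (max∉ σ∈) (max∉ σ′∈) (in-range σ∈ (ℕ.<-trans i<j j<m+1)) (in-range σ′∈ j<m+1) eq)
      where
      max∉ : ∀ {k σ} → σ ∈ filter (Q-at k) (perms n) → m ∉ σ
      max∉ σ∈ m∈σ = ℕ.<-irrefl refl (All.lookup (IsPerm.bounded (∈perms⁻ n (proj₁ (∈-filter⁻ _ σ∈)))) m∈σ)
      in-range : ∀ {k l σ} → σ ∈ filter (Q-at k) (perms n) → l < suc m → l ≤ length σ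
      in-range σ∈ l<m+2 = ℕ.≤-trans (ℕ.≤-pred l<m+2) (ℕ.≤-reflexive (sym (IsPerm.length≡ (∈perms⁻ n (proj₁ (∈-filter⁻ _ σ∈))))))

  into-blocks : ∀ {τ} → τ ∈ filter Q? (perms m) → τ ∈ blocks
  into-blocks τ∈ with τ∈perms , qτ ← ∈-filter⁻ Q? τ∈
    with L , R , refl ← ∈-∃++ (max∈perm m (∈perms⁻ m τ∈perms)) =
    ∈-concat⁺′ (subst (_∈ block p) (ins-split L R m) (∈-map⁺ (ins p m) σ∈))
               (∈-applyUpTo⁺ block p<m+2)
    where
    p = length L
    isPermσ : IsPerm n (L ++ R)
    isPermσ = perm-without-max (shift m L R) (∈perms⁻ m τ∈perms)
    σ∈ : L ++ R ∈ filter (Q-at p) (perms n)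
    σ∈ = ∈-filter⁺ (Q-at p) (∈perms⁺ n isPermσ) (subst Q (sym (ins-split L R m)) qτ)
    p<m+2 : p < suc m
    p<m+2 = begin-strict
      length L                     ≤⟨ ℕ.m≤m+n (length L) (length R) ⟩
      length L + length R          ≡⟨ List.length-++ L ⟨
      length (L ++ R)              <⟨ ℕ.n<1+n _ ⟩
      suc (length (L ++ R))        ≡⟨ cong suc (IsPerm.length≡ isPermσ) ⟩
      suc m                        ∎
      where open ℕ.≤-Reasoning

  from-blocks : ∀ {τ} → τ ∈ blocks → τ ∈ filter Q? (perms m)
  from-blocks τ∈
    with xs , τ∈xs , xs∈ ← ∈-concat⁻′ (applyUpTo block (suc m)) τ∈
    with p , _ , refl ← ∈-applyUpTo⁻ block xs∈
    with σ , σ∈ , refl ← ∈-map⁻ (ins p m) τ∈xs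
    with σ∈perms , q ← ∈-filter⁻ (Q-at p) {xs = perms n} σ∈
    = ∈-filter⁺ Q? (∈perms⁺ m (perm-with-max (ins-↭ p m σ) (∈perms⁻ n σ∈perms))) q

  count-by-max-position :
    length (filter Q? (perms m)) ≡ ∑[ p < suc m ] length (filter (Q-at p) (perms n))
  count-by-max-position = begin
    length (filter Q? (perms m))                   ≡⟨ length-by-members (Unique.filter⁺ Q? (perms-unique m)) blocks-unique into-blocks from-blocks ⟩
    length blocks                                  ≡⟨ length-concat (applyUpTo block (suc m)) ⟩
    sum (map length (applyUpTo block (suc m)))     ≡⟨ cong sum (List.map-applyUpTo block length (suc m)) ⟩
    ∑[ p < suc m ] length (block p)                ≡⟨ ∑-cong (suc m) (λ p _ → List.length-map (ins p m) (filter (Q-at p) (perms n))) ⟩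
    ∑[ p < suc m ] length (filter (Q-at p) (perms n)) ∎
    where open ≡-Reasoning

-- Constraint words.  A word cs = c₀ c₁ … c_{k-1} of steps prescribes, for each j < k,
-- how τ(j) and τ(j+1) compare: ascent, descent, or no constraint.
data Step : Set where
  asc desc free : Step

Holds : Step → ℕ → ℕ → Set
Holds asc  x y = x < y
Holds desc x y = y < x
Holds free x y = ⊤

holds? : ∀ c x y → Dec (Holds c x y)
holds? asc  x y = x <? y
holds? desc x y = y <? x
holds? free x y = yes tt

Fits : List Step → List ℕ → Set
Fits []       (x ∷ [])     = ⊤
Fits (c ∷ cs) (x ∷ y ∷ xs) = Holds c x y × Fits cs (y ∷ xs)
Fits []       []           = ⊥
Fits []       (x ∷ y ∷ xs) = ⊥
Fits (c ∷ cs) []           = ⊥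
Fits (c ∷ cs) (x ∷ [])     = ⊥

fits? : (cs : List Step) → Decidable (Fits cs)
fits? []       []           = no λ ()
fits? []       (x ∷ [])     = yes tt
fits? []       (x ∷ y ∷ xs) = no λ ()
fits? (c ∷ cs) []           = no λ ()
fits? (c ∷ cs) (x ∷ [])     = no λ ()
fits? (c ∷ cs) (x ∷ y ∷ xs) = holds? c x y ×-dec fits? cs (y ∷ xs)

count : List Step → ℕ
count cs = length (filter (fits? cs) (perms (length cs)))

-- If the maximum m of τ sits at position p, the step c_{p-1}
-- on its left must allow a rise and the step c_p on its right a fall; deleting m
-- merges these two steps into one free step.
notAsc notDesc : Step → Bool
notAsc asc   = false
notAsc _     = true
notDesc desc = false
notDesc _    = true

indicator : Bool → ℕ
indicator true  = 1
indicator false = 0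

-- maxFits cs p: the maximum may be placed at position p of a permutation fitting cs.
maxFits : List Step → ℕ → Bool
maxFits []       zero          = true
maxFits []       (suc p)       = false
maxFits (c ∷ cs) zero          = notAsc c
maxFits (c ∷ cs) (suc zero)    = notDesc c ∧ maxFits cs zero
maxFits (c ∷ cs) (suc (suc p)) = maxFits cs (suc p)

freeHead : List Step → List Step
freeHead []       = []
freeHead (c ∷ cs) = free ∷ cs

-- dropMax cs p: the word fitted by a permutation after deleting its maximum at position p.
dropMax : List Step → ℕ → List Step
dropMax []       p             = []
dropMax (c ∷ cs) zero          = cs
dropMax (c ∷ cs) (suc zero)    = freeHead cs
dropMax (c ∷ cs) (suc (suc p)) = c ∷ dropMax cs (suc p)

length-dropMax : ∀ c cs p → p ≤ suc (length cs) → length (dropMax (c ∷ cs) p) ≡ length cs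
length-dropMax c cs            zero          _        = refl
length-dropMax c []            (suc zero)    _        = refl
length-dropMax c (c′ ∷ cs)     (suc zero)    _        = refl
length-dropMax c (c′ ∷ cs)     (suc (suc p)) (s≤s p≤) = cong suc (length-dropMax c′ cs (suc p) p≤)
length-dropMax c []            (suc (suc p)) (s≤s ())

module _ {m y : ℕ} (y<m : y < m) where

  holds-from-max : ∀ c → Holds c m y ⇔ T (notAsc c)
  holds-from-max asc  = mk⇔ (ℕ.<-asym y<m) λ ()
  holds-from-max desc = mk⇔ _ (λ _ → y<m)
  holds-from-max free = mk⇔ _ _

  holds-to-max : ∀ c → Holds c y m ⇔ T (notDesc c)
  holds-to-max asc  = mk⇔ _ (λ _ → y<m)
  holds-to-max desc = mk⇔ (ℕ.<-asym y<m) λ ()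
  holds-to-max free = mk⇔ _ _

module _ {m : ℕ} where
  open Equivalence

  fits-ins→ : ∀ c cs p σ → All (_< m) σ → length σ ≡ suc (length cs) → p ≤ suc (length cs) →
    Fits (c ∷ cs) (ins p m σ) → T (maxFits (c ∷ cs) p) × Fits (dropMax (c ∷ cs) p) σ
  fits-ins→ c cs zero (y ∷ σ) (y<m ∷ _) _ _ (c-ok , σ-fits) = to (holds-from-max y<m c) c-ok , σ-fits
  fits-ins→ c [] (suc zero) (y ∷ []) (y<m ∷ _) _ _ (c-ok , _) = from T-∧ (to (holds-to-max y<m c) c-ok , _) , _
  fits-ins→ c (c′ ∷ cs) (suc zero) (y ∷ z ∷ σ) (y<m ∷ z<m ∷ _) _ _ (c-ok , c′-ok , σ-fits) =
    from T-∧ (to (holds-to-max y<m c) c-ok , to (holds-from-max z<m c′) c′-ok) , _ , σ-fits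
  fits-ins→ c (c′ ∷ cs) (suc (suc p)) (y ∷ z ∷ σ) (_ ∷ bnd) len (s≤s p≤) (c-ok , rest)
    with allowed , σ-fits ← fits-ins→ c′ cs (suc p) (z ∷ σ) bnd (ℕ.suc-injective len) p≤ rest
    = allowed , c-ok , σ-fits
  fits-ins→ c [] (suc (suc p)) (y ∷ []) _ _ (s≤s ()) _

  fits-ins← : ∀ c cs p σ → All (_< m) σ → length σ ≡ suc (length cs) →
    T (maxFits (c ∷ cs) p) → Fits (dropMax (c ∷ cs) p) σ → Fits (c ∷ cs) (ins p m σ)
  fits-ins← c cs zero (y ∷ σ) (y<m ∷ _) _ allowed σ-fits = from (holds-from-max y<m c) allowed , σ-fits
  fits-ins← c [] (suc zero) (y ∷ []) (y<m ∷ _) _ allowed _ = from (holds-to-max y<m c) (proj₁ (to T-∧ allowed)) , _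
  fits-ins← c (c′ ∷ cs) (suc zero) (y ∷ z ∷ σ) (y<m ∷ z<m ∷ _) _ allowed (_ , σ-fits) =
    let c-ok , c′-ok = to T-∧ allowed
    in from (holds-to-max y<m c) c-ok , from (holds-from-max z<m c′) c′-ok , σ-fits
  fits-ins← c (c′ ∷ cs) (suc (suc p)) (y ∷ z ∷ σ) (_ ∷ bnd) len allowed (c-ok , σ-fits) =
    c-ok , fits-ins← c′ cs (suc p) (z ∷ σ) bnd (ℕ.suc-injective len) allowed σ-fits

byMax : List Step → ℕ → ℕ
byMax cs p = indicator (maxFits cs p) * count (dropMax cs p)

-- Recursion by the position of the maximum: a permutation fitting cs is obtained
-- by inserting the maximum, at an allowed position p, into one fitting dropMax cs p.
-- (For the empty word both sides are 1.)
count-rec : ∀ cs → count cs ≡ ∑[ p < suc (length cs) ] byMax cs p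
count-rec []       = refl
count-rec (c ∷ cs) = trans (MaxPosition.count-by-max-position (fits? (c ∷ cs)) n) (∑-cong (suc (suc n)) by-position)
  where
  n = length cs
  open MaxPosition (fits? (c ∷ cs)) n using (Q-at)
  bounded : ∀ {σ} → σ ∈ perms n → All (_< suc n) σ
  bounded σ∈ = IsPerm.bounded (∈perms⁻ n σ∈)
  length≡ : ∀ {σ} → σ ∈ perms n → length σ ≡ suc n
  length≡ σ∈ = IsPerm.length≡ (∈perms⁻ n σ∈)
  by-position : ∀ p → p < suc (suc n) → length (filter (Q-at p) (perms n)) ≡ byMax (c ∷ cs) p
  by-position p p<n+2 with maxFits (c ∷ cs) p in allowed
  ... | false = count-none (Q-at p) λ σ∈ σ-fits →
        subst T allowed (proj₁ (fits-ins→ c cs p _ (bounded σ∈) (length≡ σ∈) (ℕ.≤-pred p<n+2) σ-fits))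
  ... | true = begin
    length (filter (Q-at p) (perms n))
      ≡⟨ count-cong (Q-at p) (fits? (dropMax (c ∷ cs) p)) (perms-unique n)
           (λ σ∈ σ-fits → proj₂ (fits-ins→ c cs p _ (bounded σ∈) (length≡ σ∈) (ℕ.≤-pred p<n+2) σ-fits))
           (λ σ∈ → fits-ins← c cs p _ (bounded σ∈) (length≡ σ∈) (subst T (sym allowed) tt)) ⟩
    length (filter (fits? (dropMax (c ∷ cs) p)) (perms n))
      ≡⟨ cong (λ k → length (filter (fits? (dropMax (c ∷ cs) p)) (perms k))) (length-dropMax c cs p (ℕ.≤-pred p<n+2)) ⟨
    count (dropMax (c ∷ cs) p)
      ≡⟨ ℕ.+-identityʳ _ ⟨
    1 * count (dropMax (c ∷ cs) p) ∎
    where open ≡-Reasoning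

-- Symmetry under complementation.  Replacing every entry x of a permutation of
-- {0,…,n} by n ∸ x turns ascents into descents and vice versa.
opposite : Step → Step
opposite asc  = desc
opposite desc = asc
opposite free = free

opposite-involutive : ∀ cs → map opposite (map opposite cs) ≡ cs
opposite-involutive []          = refl
opposite-involutive (asc  ∷ cs) = cong (asc  ∷_) (opposite-involutive cs)
opposite-involutive (desc ∷ cs) = cong (desc ∷_) (opposite-involutive cs)
opposite-involutive (free ∷ cs) = cong (free ∷_) (opposite-involutive cs)

-- x ↦ n ∸ x on {0,…,n}, extended by the identity so as to be an involution of ℕ.
reflect : ℕ → ℕ → ℕ
reflect n x with x ≤? n
... | yes _ = n ∸ x
... | no  _ = x

reflect-≤ : ∀ n {x} → x ≤ n → reflect n x ≡ n ∸ x
reflect-≤ n {x} x≤n with x ≤? n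
... | yes _   = refl
... | no  x≰n = contradiction x≤n x≰n

reflect-involutive : ∀ n x → reflect n (reflect n x) ≡ x
reflect-involutive n x with x ≤? n
... | yes x≤n = trans (reflect-≤ n (ℕ.m∸n≤m n x)) (ℕ.m∸[m∸n]≡n x≤n)
... | no  x≰n with x ≤? n
...   | yes x≤n = contradiction x≤n x≰n
...   | no  _   = refl

map-reflect-involutive : ∀ n xs → map (reflect n) (map (reflect n) xs) ≡ xs
map-reflect-involutive n []       = refl
map-reflect-involutive n (x ∷ xs) = cong₂ _∷_ (reflect-involutive n x) (map-reflect-involutive n xs)

map-reflect-injective : ∀ n {xs ys} → map (reflect n) xs ≡ map (reflect n) ys → xs ≡ ys
map-reflect-injective n {xs} {ys} eq =
  trans (sym (map-reflect-involutive n xs)) (trans (cong (map (reflect n)) eq) (map-reflect-involutive n ys))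

holds-reflect : ∀ c n {x y} → x ≤ n → y ≤ n → Holds c x y → Holds (opposite c) (reflect n x) (reflect n y)
holds-reflect asc  n x≤n y≤n x<y rewrite reflect-≤ n x≤n | reflect-≤ n y≤n = ℕ.∸-monoʳ-< x<y y≤n
holds-reflect desc n x≤n y≤n y<x rewrite reflect-≤ n x≤n | reflect-≤ n y≤n = ℕ.∸-monoʳ-< y<x x≤n
holds-reflect free n _   _   _   = tt

fits-reflect : ∀ cs n τ → All (_≤ n) τ → Fits cs τ → Fits (map opposite cs) (map (reflect n) τ)
fits-reflect []       n (x ∷ [])     _                 _              = tt
fits-reflect (c ∷ cs) n (x ∷ y ∷ τ) (x≤n ∷ y≤n ∷ bnd) (c-ok , τ-fits) =
  holds-reflect c n x≤n y≤n c-ok , fits-reflect cs n (y ∷ τ) (y≤n ∷ bnd) τ-fits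

reflect-perm : ∀ n {τ} → IsPerm n τ → IsPerm n (map (reflect n) τ)
reflect-perm n {τ} (isPerm len bnd u) = isPerm
  (trans (List.length-map (reflect n) τ) len)
  (All.map⁺ (All.map (λ {x} x<n+1 → subst (_< suc n) (sym (reflect-≤ n (ℕ.≤-pred x<n+1))) (s≤s (ℕ.m∸n≤m n x))) bnd))
  (Unique.map⁺ (λ {x} {y} eq → trans (sym (reflect-involutive n x)) (trans (cong (reflect n) eq) (reflect-involutive n y))) u)

count-opposite : ∀ cs → count (map opposite cs) ≡ count cs
count-opposite cs = begin
  length (filter (fits? (map opposite cs)) (perms (length (map opposite cs))))
    ≡⟨ cong (λ k → length (filter (fits? (map opposite cs)) (perms k))) (List.length-map opposite cs) ⟩
  length (filter (fits? (map opposite cs)) (perms n))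
    ≡⟨ length-by-members (Unique.filter⁺ _ (perms-unique n)) (Unique.map⁺ (map-reflect-injective n) (Unique.filter⁺ _ (perms-unique n))) to from ⟩
  length (map (map (reflect n)) (filter (fits? cs) (perms n)))
    ≡⟨ List.length-map (map (reflect n)) (filter (fits? cs) (perms n)) ⟩
  count cs ∎
  where
  open ≡-Reasoning
  n = length cs
  reflected-fits : ∀ ds {τ} → τ ∈ perms n → Fits ds τ → Fits (map opposite ds) (map (reflect n) τ)
  reflected-fits ds τ∈ = fits-reflect ds n _ (All.map ℕ.≤-pred (IsPerm.bounded (∈perms⁻ n τ∈)))
  reflected∈ : ∀ {τ} → τ ∈ perms n → map (reflect n) τ ∈ perms n
  reflected∈ τ∈ = ∈perms⁺ n (reflect-perm n (∈perms⁻ n τ∈))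
  to : ∀ {τ} → τ ∈ filter (fits? (map opposite cs)) (perms n) → τ ∈ map (map (reflect n)) (filter (fits? cs) (perms n))
  to {τ} τ∈ with τ∈perms , τ-fits ← ∈-filter⁻ (fits? (map opposite cs)) {xs = perms n} τ∈ =
    subst (_∈ _) (map-reflect-involutive n τ) (∈-map⁺ (map (reflect n))
      (∈-filter⁺ (fits? cs) (reflected∈ τ∈perms)
        (subst (λ ds → Fits ds (map (reflect n) τ)) (opposite-involutive cs) (reflected-fits (map opposite cs) τ∈perms τ-fits))))
  from : ∀ {τ} → τ ∈ map (map (reflect n)) (filter (fits? cs) (perms n)) → τ ∈ filter (fits? (map opposite cs)) (perms n)
  from τ∈ with σ , σ∈ , refl ← ∈-map⁻ (map (reflect n)) τ∈
    with σ∈perms , σ-fits ← ∈-filter⁻ (fits? cs) {xs = perms n} σ∈ =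
    ∈-filter⁺ (fits? (map opposite cs)) (reflected∈ σ∈perms) (reflected-fits cs σ∈perms σ-fits)

maxFits-left : ∀ cs₁ cs₂ p → p ≤ length cs₁ → maxFits (cs₁ ++ free ∷ cs₂) p ≡ maxFits cs₁ p
maxFits-left []             cs₂ zero          _        = refl
maxFits-left (c ∷ cs₁)      cs₂ zero          _        = refl
maxFits-left (c ∷ [])       cs₂ (suc zero)    _        = refl
maxFits-left (c ∷ c′ ∷ cs₁) cs₂ (suc zero)    _        = refl
maxFits-left (c ∷ cs₁)      cs₂ (suc (suc p)) (s≤s p≤) = maxFits-left cs₁ cs₂ (suc p) p≤

dropMax-left : ∀ c cs₁ cs₂ p → p ≤ suc (length cs₁) →
  dropMax (c ∷ cs₁ ++ free ∷ cs₂) p ≡ dropMax (c ∷ cs₁) p ++ free ∷ cs₂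
dropMax-left c cs₁         cs₂ zero          _        = refl
dropMax-left c []          cs₂ (suc zero)    _        = refl
dropMax-left c (c′ ∷ cs₁)  cs₂ (suc zero)    _        = refl
dropMax-left c (c′ ∷ cs₁)  cs₂ (suc (suc p)) (s≤s p≤) = cong (c ∷_) (dropMax-left c′ cs₁ cs₂ (suc p) p≤)
dropMax-left c []          cs₂ (suc (suc p)) (s≤s ())

maxFits-right : ∀ cs₁ cs₂ q → maxFits (cs₁ ++ free ∷ cs₂) (suc (length cs₁ + q)) ≡ maxFits cs₂ q
maxFits-right []        []        zero    = refl
maxFits-right []        (c ∷ cs₂) zero    = refl
maxFits-right []        cs₂       (suc q) = refl
maxFits-right (c ∷ cs₁) cs₂       q       = maxFits-right cs₁ cs₂ q

dropMax-right : ∀ cs₁ c cs₂ q → dropMax (cs₁ ++ free ∷ c ∷ cs₂) (suc (length cs₁ + q)) ≡ cs₁ ++ free ∷ dropMax (c ∷ cs₂) q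
dropMax-right []         c cs₂ zero    = refl
dropMax-right []         c cs₂ (suc q) = refl
dropMax-right (c′ ∷ cs₁) c cs₂ q       = cong (c′ ∷_) (dropMax-right cs₁ c cs₂ q)

dropMax-last : ∀ cs₁ → dropMax (cs₁ ++ free ∷ []) (suc (length cs₁)) ≡ cs₁
dropMax-last []        = refl
dropMax-last (c ∷ cs₁) = cong (c ∷_) (dropMax-last cs₁)

-- The free-step product formula: across a free step the two sides only share
-- which values they receive, so with a = |cs₁|, b = |cs₂|,
--   count (cs₁ ++ free ∷ cs₂) = C(a+b+2, a+1) · count cs₁ · count cs₂.
FreeSplit : List Step → List Step → Set
FreeSplit cs₁ cs₂ = count (cs₁ ++ free ∷ cs₂) ≡
  (suc (suc (length cs₁ + length cs₂)) C suc (length cs₁)) * (count cs₁ * count cs₂)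

private
  rearrange : ∀ i k x y → i * (k * (x * y)) ≡ (k * y) * (i * x)
  rearrange = solve-∀

  rearrange′ : ∀ i k x y → i * (k * (x * y)) ≡ (k * x) * (i * y)
  rearrange′ = solve-∀

  unit-left : ∀ x → 1 * x + 0 ≡ 1 * (1 * x)
  unit-left = solve-∀

  unit-right : ∀ x → 1 * x + 0 ≡ 1 * (x * 1)
  unit-right = solve-∀

-- The permutations of count-rec with their maximum left of the free step.
max-left : ∀ cs₁ cs₂ → (∀ ds₁ → length ds₁ < length cs₁ → FreeSplit ds₁ cs₂) →
  ∑[ p < suc (length cs₁) ] byMax (cs₁ ++ free ∷ cs₂) p ≡
  (suc (length cs₁ + length cs₂) C length cs₁) * (count cs₁ * count cs₂)
max-left []        cs₂ _  = unit-left (count cs₂)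
max-left (c ∷ cs₁) cs₂ IH = begin
  ∑[ p < suc a ] byMax (c ∷ cs₁ ++ free ∷ cs₂) p ≡⟨ ∑-cong (suc a) split-term ⟩
  ∑[ p < suc a ] (k * byMax (c ∷ cs₁) p)        ≡⟨ ∑-scale (suc a) k (byMax (c ∷ cs₁)) ⟩
  k * ∑[ p < suc a ] byMax (c ∷ cs₁) p          ≡⟨ cong (k *_) (count-rec (c ∷ cs₁)) ⟨
  k * count (c ∷ cs₁)                           ≡⟨ ℕ.*-assoc binom (count cs₂) _ ⟩
  binom * (count cs₂ * count (c ∷ cs₁))         ≡⟨ cong (binom *_) (ℕ.*-comm (count cs₂) _) ⟩
  binom * (count (c ∷ cs₁) * count cs₂)         ∎
  where
  open ≡-Reasoning
  a = length (c ∷ cs₁)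
  b = length cs₂
  binom = suc (a + b) C a
  k = binom * count cs₂
  split-term : ∀ p → p < suc a → byMax (c ∷ cs₁ ++ free ∷ cs₂) p ≡ k * byMax (c ∷ cs₁) p
  split-term p p<a+1 = begin
    indicator (maxFits (c ∷ cs₁ ++ free ∷ cs₂) p) * count (dropMax (c ∷ cs₁ ++ free ∷ cs₂) p)
      ≡⟨ cong₂ (λ ok d → indicator ok * count d) (maxFits-left (c ∷ cs₁) cs₂ p (ℕ.≤-pred p<a+1)) (dropMax-left c cs₁ cs₂ p (ℕ.≤-pred p<a+1)) ⟩
    i * count (ds₁ ++ free ∷ cs₂)
      ≡⟨ cong (i *_) (IH ds₁ (ℕ.≤-reflexive (cong suc shorter))) ⟩
    i * ((suc (suc (length ds₁ + b)) C suc (length ds₁)) * (count ds₁ * count cs₂))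
      ≡⟨ cong (λ z → i * (z * (count ds₁ * count cs₂))) same-binom ⟩
    i * (binom * (count ds₁ * count cs₂))
      ≡⟨ rearrange i binom (count ds₁) (count cs₂) ⟩
    k * (i * count ds₁) ∎
    where
    i = indicator (maxFits (c ∷ cs₁) p)
    ds₁ = dropMax (c ∷ cs₁) p
    shorter : length ds₁ ≡ length cs₁
    shorter = length-dropMax c cs₁ p (ℕ.≤-pred p<a+1)
    same-binom : suc (suc (length ds₁ + b)) C suc (length ds₁) ≡ binom
    same-binom = cong (λ l → suc (suc (l + b)) C suc l) shorter

-- The permutations of count-rec with their maximum right of the free step.
max-right : ∀ cs₁ cs₂ → (∀ ds₂ → length ds₂ < length cs₂ → FreeSplit cs₁ ds₂) →
  ∑[ q < suc (length cs₂) ] byMax (cs₁ ++ free ∷ cs₂) (suc (length cs₁ + q)) ≡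
  (suc (length cs₁ + length cs₂) C suc (length cs₁)) * (count cs₁ * count cs₂)
max-right cs₁ [] _ = begin
  indicator (maxFits (cs₁ ++ free ∷ []) (suc (a + 0))) * count (dropMax (cs₁ ++ free ∷ []) (suc (a + 0))) + 0
    ≡⟨ cong₂ (λ ok d → indicator ok * count d + 0) (maxFits-right cs₁ [] 0) (cong (λ l → dropMax (cs₁ ++ free ∷ []) (suc l)) (ℕ.+-identityʳ a)) ⟩
  1 * count (dropMax (cs₁ ++ free ∷ []) (suc a)) + 0
    ≡⟨ cong (λ ds → 1 * count ds + 0) (dropMax-last cs₁) ⟩
  1 * count cs₁ + 0
    ≡⟨ unit-right (count cs₁) ⟩
  1 * (count cs₁ * 1)
    ≡⟨ cong (_* (count cs₁ * 1)) (trans (sym (nCn≡1 (suc a))) (cong (λ l → suc l C suc a) (sym (ℕ.+-identityʳ a)))) ⟩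
  (suc (a + 0) C suc a) * (count cs₁ * count []) ∎
  where
  open ≡-Reasoning
  a = length cs₁
max-right cs₁ (c ∷ cs₂) IH = begin
  ∑[ q < suc b ] byMax (cs₁ ++ free ∷ c ∷ cs₂) (suc (a + q)) ≡⟨ ∑-cong (suc b) split-term ⟩
  ∑[ q < suc b ] (k * byMax (c ∷ cs₂) q)                     ≡⟨ ∑-scale (suc b) k (byMax (c ∷ cs₂)) ⟩
  k * ∑[ q < suc b ] byMax (c ∷ cs₂) q                       ≡⟨ cong (k *_) (count-rec (c ∷ cs₂)) ⟨
  k * count (c ∷ cs₂)                                        ≡⟨ ℕ.*-assoc binom (count cs₁) _ ⟩
  binom * (count cs₁ * count (c ∷ cs₂))                      ∎
  where
  open ≡-Reasoning
  a = length cs₁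
  b = length (c ∷ cs₂)
  binom = suc (a + b) C suc a
  k = binom * count cs₁
  split-term : ∀ q → q < suc b → byMax (cs₁ ++ free ∷ c ∷ cs₂) (suc (a + q)) ≡ k * byMax (c ∷ cs₂) q
  split-term q q<b+1 = begin
    indicator (maxFits (cs₁ ++ free ∷ c ∷ cs₂) (suc (a + q))) * count (dropMax (cs₁ ++ free ∷ c ∷ cs₂) (suc (a + q)))
      ≡⟨ cong₂ (λ ok d → indicator ok * count d) (maxFits-right cs₁ (c ∷ cs₂) q) (dropMax-right cs₁ c cs₂ q) ⟩
    i * count (cs₁ ++ free ∷ ds₂)
      ≡⟨ cong (i *_) (IH ds₂ (ℕ.≤-reflexive (cong suc shorter))) ⟩
    i * ((suc (suc (a + length ds₂)) C suc a) * (count cs₁ * count ds₂))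
      ≡⟨ cong (λ l → i * ((suc (suc (a + l)) C suc a) * (count cs₁ * count ds₂))) shorter ⟩
    i * ((suc (suc (a + length cs₂)) C suc a) * (count cs₁ * count ds₂))
      ≡⟨ cong (λ l → i * ((suc l C suc a) * (count cs₁ * count ds₂))) (ℕ.+-suc a (length cs₂)) ⟨
    i * (binom * (count cs₁ * count ds₂))
      ≡⟨ rearrange′ i binom (count cs₁) (count ds₂) ⟩
    k * (i * count ds₂) ∎
    where
    i = indicator (maxFits (c ∷ cs₂) q)
    ds₂ = dropMax (c ∷ cs₂) q
    shorter : length ds₂ ≡ length cs₂
    shorter = length-dropMax c cs₂ q (ℕ.≤-pred q<b+1)

free-split : ∀ cs₁ cs₂ → FreeSplit cs₁ cs₂
free-split cs₁ cs₂ = bounded (suc (length cs₁ + length cs₂)) cs₁ cs₂ ℕ.≤-refl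
  where
  bounded : ∀ N cs₁ cs₂ → length cs₁ + length cs₂ < N → FreeSplit cs₁ cs₂
  bounded (suc N) cs₁ cs₂ size<N = begin
    count (cs₁ ++ free ∷ cs₂)                                       ≡⟨ count-rec (cs₁ ++ free ∷ cs₂) ⟩
    ∑[ p < suc (length (cs₁ ++ free ∷ cs₂)) ] byMax word p          ≡⟨ cong (λ l → ∑< (suc l) (byMax word)) (List.length-++ cs₁) ⟩
    ∑< (suc a + suc b) (byMax word)                                 ≡⟨ ∑-split (suc a) (suc b) (byMax word) ⟩
    ∑< (suc a) (byMax word) + ∑[ q < suc b ] byMax word (suc a + q) ≡⟨ cong₂ _+_ left right ⟩
    (suc n C a) * x + (suc n C suc a) * x                           ≡⟨ ℕ.*-distribʳ-+ x (suc n C a) _ ⟨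
    (suc n C a + suc n C suc a) * x                                 ≡⟨ cong (_* x) (nCk+nC[k+1]≡[n+1]C[k+1] (suc n) a) ⟩
    (suc (suc n) C suc a) * x                                       ∎
    where
    open ≡-Reasoning
    a = length cs₁
    b = length cs₂
    n = a + b
    x = count cs₁ * count cs₂
    word = cs₁ ++ free ∷ cs₂
    size≤N = ℕ.≤-pred size<N
    left = max-left cs₁ cs₂ λ ds₁ ds₁<cs₁ →
      bounded N ds₁ cs₂ (ℕ.≤-trans (ℕ.+-monoˡ-≤ b ds₁<cs₁) size≤N)
    right = max-right cs₁ cs₂ λ ds₂ ds₂<cs₂ →
      bounded N cs₁ ds₂ (ℕ.≤-trans (ℕ.≤-reflexive (sym (ℕ.+-suc a _))) (ℕ.≤-trans (ℕ.+-monoʳ-≤ a ds₂<cs₂) size≤N))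

dropMax-middle : ∀ cs p → suc p < length cs → dropMax cs (suc p) ≡ take p cs ++ free ∷ drop (suc (suc p)) cs
dropMax-middle (c ∷ c′ ∷ cs) zero    _          = refl
dropMax-middle (c ∷ c′ ∷ cs) (suc p) (s≤s p<)   = cong (c ∷_) (dropMax-middle (c′ ∷ cs) p p<)
dropMax-middle (c ∷ [])      (suc p) (s≤s ())

dropMax-end : ∀ c cs → dropMax (c ∷ cs) (length (c ∷ cs)) ≡ take (length cs) (c ∷ cs)
dropMax-end c []        = refl
dropMax-end c (c′ ∷ cs) = cong (c ∷_) (dropMax-end c′ cs)

-- The number of permutations fitting the word cs with position p removed.
splitCount : List Step → ℕ → ℕ
splitCount cs p = (length cs C p) * (count (take (p ∸ 1) cs) * count (drop (suc p) cs))

count-dropMax : ∀ c cs p → p ≤ length (c ∷ cs) → count (dropMax (c ∷ cs) p) ≡ splitCount (c ∷ cs) p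
count-dropMax c cs zero _ = sym (trans (ℕ.+-identityʳ _) (ℕ.+-identityʳ _))
count-dropMax c cs (suc p) p≤L with ℕ.m≤n⇒m<n∨m≡n p≤L
... | inj₂ p+1≡L rewrite ℕ.suc-injective p+1≡L = begin
  count (dropMax (c ∷ cs) (length (c ∷ cs)))               ≡⟨ cong count (dropMax-end c cs) ⟩
  count (take (length cs) (c ∷ cs))                        ≡⟨ ℕ.*-identityʳ _ ⟨
  count (take (length cs) (c ∷ cs)) * 1
    ≡⟨ cong (λ ds → count (take (length cs) (c ∷ cs)) * count ds) (List.drop-all (suc (length cs)) cs (ℕ.n≤1+n _)) ⟨
  count (take (length cs) (c ∷ cs)) * count (drop (suc (length cs)) cs) ≡⟨ ℕ.*-identityˡ _ ⟨
  1 * (count (take (length cs) (c ∷ cs)) * count (drop (suc (length cs)) cs))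
    ≡⟨ cong (_* (count (take (length cs) (c ∷ cs)) * count (drop (suc (length cs)) cs))) (nCn≡1 (length (c ∷ cs))) ⟨
  splitCount (c ∷ cs) (length (c ∷ cs)) ∎
  where open ≡-Reasoning
... | inj₁ p+1<L = begin
  count (dropMax (c ∷ cs) (suc p))                                  ≡⟨ cong count (dropMax-middle (c ∷ cs) p p+1<L) ⟩
  count (before ++ free ∷ after)                                    ≡⟨ free-split before after ⟩
  (suc (suc (length before + length after)) C suc (length before)) * x ≡⟨ cong (λ k → (k C suc (length before)) * x) total ⟩
  (length (c ∷ cs) C suc (length before)) * x                       ≡⟨ cong (λ k → (length (c ∷ cs) C suc k) * x) length-before ⟩
  splitCount (c ∷ cs) (suc p)                                       ∎
  where
  open ≡-Reasoning
  before = take p (c ∷ cs)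
  after = drop (suc (suc p)) (c ∷ cs)
  x = count before * count after
  length-before : length before ≡ p
  length-before = trans (List.length-take p (c ∷ cs)) (ℕ.m≤n⇒m⊓n≡m (ℕ.<⇒≤ (ℕ.<-trans (ℕ.n<1+n p) p+1<L)))
  total : suc (suc (length before + length after)) ≡ length (c ∷ cs)
  total = begin
    suc (suc (length before + length after))       ≡⟨ cong₂ (λ l l′ → suc (suc (l + l′))) length-before (List.length-drop (suc (suc p)) (c ∷ cs)) ⟩
    suc (suc (p + (length (c ∷ cs) ∸ suc (suc p)))) ≡⟨ ℕ.m+[n∸m]≡n p+1<L ⟩
    length (c ∷ cs)                                ∎

minFits : List Step → ℕ → Bool
minFits cs = maxFits (map opposite cs)

extremes : List Step → ℕ → ℕ
extremes cs p = indicator (maxFits cs p) + indicator (minFits cs p)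

freeHead-opposite : ∀ cs → freeHead (map opposite cs) ≡ map opposite (freeHead cs)
freeHead-opposite []       = refl
freeHead-opposite (c ∷ cs) = refl

dropMax-opposite : ∀ cs p → dropMax (map opposite cs) p ≡ map opposite (dropMax cs p)
dropMax-opposite []       p             = refl
dropMax-opposite (c ∷ cs) zero          = refl
dropMax-opposite (c ∷ cs) (suc zero)    = freeHead-opposite cs
dropMax-opposite (c ∷ cs) (suc (suc p)) = cong (opposite c ∷_) (dropMax-opposite cs (suc p))

-- Counting each permutation twice, once by the position of its maximum and once by
-- the position of its minimum (the maximum of its complement).
twice-count : ∀ c cs → 2 * count (c ∷ cs) ≡ ∑[ p < suc (length (c ∷ cs)) ] (extremes (c ∷ cs) p * splitCount (c ∷ cs) p)
twice-count c cs = begin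
  2 * count word                                                  ≡⟨ cong (_+_ (count word)) (ℕ.+-identityʳ _) ⟩
  count word + count word                                         ≡⟨ cong (_+_ (count word)) (count-opposite word) ⟨
  count word + count (map opposite word)                          ≡⟨ cong₂ _+_ (count-rec word) (count-rec (map opposite word)) ⟩
  ∑< (suc L) (byMax word) + ∑< (suc (length (map opposite word))) (byMax (map opposite word))
    ≡⟨ cong (λ l → ∑< (suc L) (byMax word) + ∑< (suc l) (byMax (map opposite word))) (List.length-map opposite word) ⟩
  ∑< (suc L) (byMax word) + ∑< (suc L) (byMax (map opposite word)) ≡⟨ ∑-+ (suc L) (byMax word) (byMax (map opposite word)) ⟨
  ∑[ p < suc L ] (byMax word p + byMax (map opposite word) p)      ≡⟨ ∑-cong (suc L) per-position ⟩
  ∑[ p < suc L ] (extremes word p * splitCount word p)             ∎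
  where
  open ≡-Reasoning
  word = c ∷ cs
  L = length word
  per-position : ∀ p → p < suc L → byMax word p + byMax (map opposite word) p ≡ extremes word p * splitCount word p
  per-position p p≤L = begin
    indicator (maxFits word p) * count (dropMax word p) + indicator (minFits word p) * count (dropMax (map opposite word) p)
      ≡⟨ cong (λ ds → indicator (maxFits word p) * count (dropMax word p) + indicator (minFits word p) * count ds) (dropMax-opposite word p) ⟩
    indicator (maxFits word p) * count (dropMax word p) + indicator (minFits word p) * count (map opposite (dropMax word p))
      ≡⟨ cong (λ k → indicator (maxFits word p) * count (dropMax word p) + indicator (minFits word p) * k) (count-opposite (dropMax word p)) ⟩
    indicator (maxFits word p) * count (dropMax word p) + indicator (minFits word p) * count (dropMax word p)
      ≡⟨ ℕ.*-distribʳ-+ (count (dropMax word p)) (indicator (maxFits word p)) _ ⟨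
    extremes word p * count (dropMax word p)
      ≡⟨ cong (extremes word p *_) (count-dropMax c cs p (ℕ.≤-pred p≤L)) ⟩
    extremes word p * splitCount word p ∎

step : Dir → Step
step up   = asc
step down = desc

runWord : Dir → List ℕ → List Step
runWord d as = map step (dirsFrom d as)

extremes-start : ∀ d a is → extremes (runWord d (suc a ∷ is)) 0 ≡ 1
extremes-start up   a is = refl
extremes-start down a is = refl

extremes-inside : ∀ d j a is → j < a → extremes (runWord d (suc a ∷ is)) (suc j) ≡ 0
extremes-inside up   zero    (suc a) is _         = refl
extremes-inside down zero    (suc a) is _         = refl
extremes-inside d    (suc j) (suc a) is (s≤s j<a) = extremes-inside d j a is j<a

extremes-end : ∀ d a → extremes (runWord d (suc a ∷ [])) (suc a) ≡ 1
extremes-end up   zero    = refl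
extremes-end down zero    = refl
extremes-end d    (suc a) = extremes-end d a

-- Past the first run, positions are those of the remaining runs (with the
-- opposite starting direction); the boundary between runs counts for the latter.
extremes-shift : ∀ d a b is q → extremes (runWord d (suc a ∷ suc b ∷ is)) (suc (a + q)) ≡ extremes (runWord (flipDir d) (suc b ∷ is)) q
extremes-shift up   zero    b is zero    = refl
extremes-shift down zero    b is zero    = refl
extremes-shift d    zero    b is (suc q) = refl
extremes-shift d    (suc a) b is q       = extremes-shift d a b is q

∑-gap : ∀ a m G → (∀ j → j < a → G (suc j) ≡ 0) → ∑< (suc (suc (a + m))) G ≡ G 0 + ∑[ q < suc m ] G (suc (a + q))
∑-gap a m G vanish = cong (_+_ (G 0)) (begin
  ∑< (suc (a + m)) (G ∘ suc)                                 ≡⟨ cong (λ l → ∑< l (G ∘ suc)) (ℕ.+-suc a m) ⟨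
  ∑< (a + suc m) (G ∘ suc)                                   ≡⟨ ∑-split a (suc m) (G ∘ suc) ⟩
  ∑< a (G ∘ suc) + ∑[ q < suc m ] G (suc (a + q))            ≡⟨ cong (_+ ∑[ q < suc m ] G (suc (a + q))) (∑-zero a (G ∘ suc) vanish) ⟩
  ∑[ q < suc m ] G (suc (a + q))                             ∎)
  where open ≡-Reasoning

∑-boundaries : ∀ d is → is ≢ [] → All (0 <_) is → (F : ℕ → ℕ) →
  ∑[ p < suc (sum is) ] (extremes (runWord d is) p * F p) ≡ ∑[ k < suc (length is) ] F (sum (take k is))
∑-boundaries d [] is≢[] _ F = contradiction refl is≢[]
∑-boundaries d (suc a ∷ []) _ _ F = begin
  ∑< (suc (suc (a + 0))) G                     ≡⟨ ∑-gap a 0 G inside ⟩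
  G 0 + (G (suc (a + 0)) + 0)                  ≡⟨ cong (λ l → G 0 + (G (suc l) + 0)) (ℕ.+-identityʳ a) ⟩
  G 0 + (G (suc a) + 0)                        ≡⟨ cong₂ (λ x y → x * F 0 + (y * F (suc a) + 0)) (extremes-start d a []) (extremes-end d a) ⟩
  1 * F 0 + (1 * F (suc a) + 0)
    ≡⟨ cong₂ (λ x y → x + (y + 0)) (ℕ.*-identityˡ (F 0)) (trans (ℕ.*-identityˡ _) (cong (F ∘ suc) (sym (ℕ.+-identityʳ a)))) ⟩
  F 0 + (F (suc (a + 0)) + 0)                  ∎
  where
  open ≡-Reasoning
  G = λ p → extremes (runWord d (suc a ∷ [])) p * F p
  inside : ∀ j → j < a → G (suc j) ≡ 0
  inside j j<a = cong (_* F (suc j)) (extremes-inside d j a [] j<a)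
∑-boundaries d (suc a ∷ suc b ∷ is) _ (_ ∷ rest>0) F = begin
  ∑< (suc (suc (a + sum rest))) G                                          ≡⟨ ∑-gap a (sum rest) G inside ⟩
  G 0 + ∑[ q < suc (sum rest) ] G (suc (a + q))
    ≡⟨ cong₂ _+_ (cong (_* F 0) (extremes-start d a rest)) (∑-cong (suc (sum rest)) later-runs) ⟩
  1 * F 0 + ∑[ q < suc (sum rest) ] (extremes (runWord (flipDir d) rest) q * F (suc a + q))
    ≡⟨ cong₂ _+_ (ℕ.*-identityˡ (F 0)) (∑-boundaries (flipDir d) rest (λ ()) rest>0 (λ q → F (suc a + q))) ⟩
  F 0 + ∑[ k < suc (length rest) ] F (suc a + sum (take k rest))           ∎
  where
  open ≡-Reasoning
  rest = suc b ∷ is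
  G = λ p → extremes (runWord d (suc a ∷ rest)) p * F p
  inside : ∀ j → j < a → G (suc j) ≡ 0
  inside j j<a = cong (_* F (suc j)) (extremes-inside d j a rest j<a)
  later-runs : ∀ q → q < suc (sum rest) → G (suc (a + q)) ≡ extremes (runWord (flipDir d) rest) q * F (suc a + q)
  later-runs q _ = cong (_* F (suc a + q)) (extremes-shift d a b is q)
∑-boundaries d (suc a ∷ zero ∷ is) _ (_ ∷ () ∷ _) F
∑-boundaries d (zero ∷ is) _ (() ∷ _) F

follows⇔fits : ∀ ds τ → Follows ds τ ⇔ Fits (map step ds) τ
follows⇔fits []          []          = mk⇔ id id
follows⇔fits []          (x ∷ [])    = mk⇔ id id
follows⇔fits []          (x ∷ y ∷ τ) = mk⇔ id id
follows⇔fits (up ∷ ds)   []          = mk⇔ id id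
follows⇔fits (down ∷ ds) []          = mk⇔ id id
follows⇔fits (up ∷ ds)   (x ∷ [])    = mk⇔ id id
follows⇔fits (down ∷ ds) (x ∷ [])    = mk⇔ id id
follows⇔fits (up ∷ ds)   (x ∷ y ∷ τ) = ⇔-refl ×-⇔ follows⇔fits ds (y ∷ τ)
follows⇔fits (down ∷ ds) (x ∷ y ∷ τ) = ⇔-refl ×-⇔ follows⇔fits ds (y ∷ τ)

length-dirsFrom : ∀ d as → length (dirsFrom d as) ≡ sum as
length-dirsFrom d []       = refl
length-dirsFrom d (a ∷ as) = trans (List.length-++ (replicate a d)) (cong₂ _+_ (List.length-replicate a) (length-dirsFrom (flipDir d) as))

length-runWord : ∀ d as → length (runWord d as) ≡ sum as
length-runWord d as = trans (List.length-map step (dirsFrom d as)) (length-dirsFrom d as)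

Ω≡count : ∀ as → Ω as ≡ count (runWord up as)
Ω≡count as = begin
  length (filter (follows? (runDirs as)) (perms (sum as)))
    ≡⟨ count-cong (follows? (runDirs as)) (fits? (runWord up as)) (perms-unique (sum as))
         (λ _ → Equivalence.to (follows⇔fits (runDirs as) _)) (λ _ → Equivalence.from (follows⇔fits (runDirs as) _)) ⟩
  length (filter (fits? (runWord up as)) (perms (sum as)))
    ≡⟨ cong (λ n → length (filter (fits? (runWord up as)) (perms n))) (length-runWord up as) ⟨
  count (runWord up as) ∎
  where open ≡-Reasoning

-- Starting downwards instead gives the complementary word, hence also Ω.
runWord-flip : ∀ d as → map opposite (runWord d as) ≡ runWord (flipDir d) as
runWord-flip d []       = refl
runWord-flip d (a ∷ as) = begin
  map opposite (map step (replicate a d ++ dirsFrom (flipDir d) as))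
    ≡⟨ cong (map opposite) (List.map-++ step (replicate a d) _) ⟩
  map opposite (map step (replicate a d) ++ runWord (flipDir d) as)
    ≡⟨ List.map-++ opposite (map step (replicate a d)) _ ⟩
  map opposite (map step (replicate a d)) ++ map opposite (runWord (flipDir d) as)
    ≡⟨ cong₂ _++_ (flip-replicate a d) (runWord-flip (flipDir d) as) ⟩
  map step (replicate a (flipDir d)) ++ runWord (flipDir (flipDir d)) as
    ≡⟨ List.map-++ step (replicate a (flipDir d)) _ ⟨
  runWord (flipDir d) (a ∷ as) ∎
  where
  open ≡-Reasoning
  flip-replicate : ∀ a d → map opposite (map step (replicate a d)) ≡ map step (replicate a (flipDir d))
  flip-replicate zero    d    = refl
  flip-replicate (suc a) up   = cong (desc ∷_) (flip-replicate a up)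
  flip-replicate (suc a) down = cong (asc ∷_) (flip-replicate a down)

count-runWord : ∀ d as → count (runWord d as) ≡ Ω as
count-runWord up   as = sym (Ω≡count as)
count-runWord down as = begin
  count (runWord down as)                ≡⟨ cong count (runWord-flip up as) ⟨
  count (map opposite (runWord up as))   ≡⟨ count-opposite (runWord up as) ⟩
  count (runWord up as)                  ≡⟨ Ω≡count as ⟨
  Ω as                                   ∎
  where open ≡-Reasoning

dirAfter : Dir → List ℕ → Dir
dirAfter d []       = d
dirAfter d (a ∷ as) = dirAfter (flipDir d) as

dirsFrom-++ : ∀ d as bs → dirsFrom d (as ++ bs) ≡ dirsFrom d as ++ dirsFrom (dirAfter d as) bs
dirsFrom-++ d []       bs = refl
dirsFrom-++ d (a ∷ as) bs = trans (cong (replicate a d ++_) (dirsFrom-++ (flipDir d) as bs))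
                                  (sym (List.++-assoc (replicate a d) _ _))

take-++ˡ : {A : Set} (n : ℕ) (xs ys : List A) → n ≤ length xs → take n (xs ++ ys) ≡ take n xs
take-++ˡ zero    xs       ys _        = refl
take-++ˡ (suc n) (x ∷ xs) ys (s≤s n≤) = cong (x ∷_) (take-++ˡ n xs ys n≤)

drop-++-suc : {A : Set} (xs ys : List A) → drop (suc (length xs)) (xs ++ ys) ≡ drop 1 ys
drop-++-suc []       ys = refl
drop-++-suc (x ∷ xs) ys = drop-++-suc xs ys

take-decLast : ∀ d as → All (0 <_) as → take (sum as ∸ 1) (dirsFrom d as) ≡ dirsFrom d (decLast as)
take-decLast d []                          _              = refl
take-decLast d (suc zero ∷ [])             _              = refl
take-decLast d (suc (suc a) ∷ [])          _              = cong (d ∷_) (take-decLast d (suc a ∷ []) (s≤s z≤n ∷ []))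
take-decLast d (suc zero ∷ suc b ∷ as)     (_ ∷ as>0)     = cong (d ∷_) (take-decLast (flipDir d) (suc b ∷ as) as>0)
take-decLast d (suc (suc a) ∷ suc b ∷ as)  (_ ∷ as>0)     = cong (d ∷_) (take-decLast d (suc a ∷ suc b ∷ as) (s≤s z≤n ∷ as>0))
take-decLast d (suc a ∷ zero ∷ as)         (_ ∷ () ∷ _)
take-decLast d (zero ∷ as)                 (() ∷ _)

drop-decHead : ∀ d as → All (0 <_) as → drop 1 (dirsFrom d as) ≡ dirsFrom d (decHead as)
drop-decHead d []           _       = refl
drop-decHead d (suc a ∷ as) _       = refl
drop-decHead d (zero ∷ as)  (() ∷ _)

splitCount-boundary : ∀ is k → All (0 <_) is →
  splitCount (runWord up is) (sum (take k is)) ≡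
  (sum is C sum (take k is)) * (Ω (decLast (take k is)) * Ω (decHead (drop k is)))
splitCount-boundary is k is>0 = begin
  (length (runWord up is) C t) * (count (take (t ∸ 1) (runWord up is)) * count (drop (suc t) (runWord up is)))
    ≡⟨ cong (λ n → (n C t) * (count (take (t ∸ 1) (runWord up is)) * count (drop (suc t) (runWord up is)))) (length-runWord up is) ⟩
  (sum is C t) * (count (take (t ∸ 1) (runWord up is)) * count (drop (suc t) (runWord up is)))
    ≡⟨ cong ((sum is C t) *_) (cong₂ _*_ before after) ⟩
  (sum is C t) * (Ω (decLast (take k is)) * Ω (decHead (drop k is))) ∎
  where
  open ≡-Reasoning
  t = sum (take k is)
  D₁ = dirsFrom up (take k is)
  D₂ = dirsFrom (dirAfter up (take k is)) (drop k is)
  pattern-split : runDirs is ≡ D₁ ++ D₂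
  pattern-split = trans (cong (dirsFrom up) (sym (List.take++drop≡id k is))) (dirsFrom-++ up (take k is) (drop k is))
  length-D₁ : length D₁ ≡ t
  length-D₁ = length-dirsFrom up (take k is)
  before : count (take (t ∸ 1) (runWord up is)) ≡ Ω (decLast (take k is))
  before = begin
    count (take (t ∸ 1) (map step (runDirs is)))    ≡⟨ cong count (List.take-map (t ∸ 1) (runDirs is)) ⟩
    count (map step (take (t ∸ 1) (runDirs is)))    ≡⟨ cong (λ D → count (map step (take (t ∸ 1) D))) pattern-split ⟩
    count (map step (take (t ∸ 1) (D₁ ++ D₂)))
      ≡⟨ cong (count ∘ map step) (take-++ˡ (t ∸ 1) D₁ D₂ (ℕ.≤-trans (ℕ.m∸n≤m t 1) (ℕ.≤-reflexive (sym length-D₁)))) ⟩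
    count (map step (take (t ∸ 1) D₁))              ≡⟨ cong (count ∘ map step) (take-decLast up (take k is) (All.take⁺ k is>0)) ⟩
    count (runWord up (decLast (take k is)))        ≡⟨ count-runWord up (decLast (take k is)) ⟩
    Ω (decLast (take k is))                         ∎
    where open ≡-Reasoning
  after : count (drop (suc t) (runWord up is)) ≡ Ω (decHead (drop k is))
  after = begin
    count (drop (suc t) (map step (runDirs is)))    ≡⟨ cong count (List.drop-map (suc t) (runDirs is)) ⟩
    count (map step (drop (suc t) (runDirs is)))    ≡⟨ cong (λ D → count (map step (drop (suc t) D))) pattern-split ⟩
    count (map step (drop (suc t) (D₁ ++ D₂)))      ≡⟨ cong (λ l → count (map step (drop (suc l) (D₁ ++ D₂)))) length-D₁ ⟨
    count (map step (drop (suc (length D₁)) (D₁ ++ D₂))) ≡⟨ cong (count ∘ map step) (drop-++-suc D₁ D₂) ⟩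
    count (map step (drop 1 D₂))                    ≡⟨ cong (count ∘ map step) (drop-decHead _ (drop k is) (All.drop⁺ k is>0)) ⟩
    count (runWord (dirAfter up (take k is)) (decHead (drop k is))) ≡⟨ count-runWord _ (decHead (drop k is)) ⟩
    Ω (decHead (drop k is))                         ∎
    where open ≡-Reasoning

twice-Ω : ∀ is → is ≢ [] → All (0 <_) is →
  2 * Ω is ≡ ∑[ k < suc (length is) ] ((sum is C sum (take k is)) * (Ω (decLast (take k is)) * Ω (decHead (drop k is))))
twice-Ω []                 is≢[] _      = contradiction refl is≢[]
twice-Ω (zero ∷ rest)      _     (() ∷ _)
twice-Ω is@(suc a ∷ rest)  is≢[] is>0   = begin
  2 * Ω is                                                          ≡⟨ cong (2 *_) (Ω≡count is) ⟩
  2 * count word                                                    ≡⟨ twice-count asc (runWord up (a ∷ rest)) ⟩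
  ∑[ p < suc (length word) ] (extremes word p * splitCount word p)  ≡⟨ cong (λ l → ∑[ p < suc l ] (extremes word p * splitCount word p)) (length-runWord up is) ⟩
  ∑[ p < suc (sum is) ] (extremes word p * splitCount word p)       ≡⟨ ∑-boundaries up is is≢[] is>0 (splitCount word) ⟩
  ∑[ k < suc (length is) ] splitCount word (sum (take k is))        ≡⟨ ∑-cong (suc (length is)) (λ k _ → splitCount-boundary is k is>0) ⟩
  ∑[ k < suc (length is) ] ((sum is C sum (take k is)) * (Ω (decLast (take k is)) * Ω (decHead (drop k is)))) ∎
  where
  open ≡-Reasoning
  word = runWord up is

binomial-factorials : ∀ t s → ((t + s) C t) * (t ! * s !) ≡ (t + s) !
binomial-factorials t s = begin
  ((t + s) C t) * (t ! * s !)               ≡⟨ cong (λ u → ((t + s) C t) * (t ! * u !)) (ℕ.m+n∸m≡n t s) ⟨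
  ((t + s) C t) * (t ! * (t + s ∸ t) !)     ≡⟨ cong (_* (t ! * (t + s ∸ t) !)) (nCk≡n!/k![n-k]! t≤t+s) ⟩
  ((t + s) ! div (t ! * (t + s ∸ t) !)) {{t !* (t + s ∸ t) !≢0}} * (t ! * (t + s ∸ t) !)
    ≡⟨ m/n*n≡m {{t !* (t + s ∸ t) !≢0}} (k![n∸k]!∣n! t≤t+s) ⟩
  (t + s) ! ∎
  where
  open ≡-Reasoning
  t≤t+s = ℕ.m≤m+n t s

-- Decreasing the last (resp. first) entry of a positive list lowers its sum by one;
-- the factorials below also agree for the empty list, where both sums are 0.
decLast-factorial : ∀ as → All (0 <_) as → suc (sum (decLast as)) ! ≡ sum as !
decLast-factorial []       _    = refl
decLast-factorial (a ∷ as) as>0 = cong _! (suc-sum a as as>0)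
  where
  suc-sum : ∀ a as → All (0 <_) (a ∷ as) → suc (sum (decLast (a ∷ as))) ≡ sum (a ∷ as)
  suc-sum (suc a) []       _            = refl
  suc-sum a       (b ∷ as) (_ ∷ as>0)   = trans (sym (ℕ.+-suc a _)) (cong (_+_ a) (suc-sum b as as>0))

decHead-factorial : ∀ as → All (0 <_) as → suc (sum (decHead as)) ! ≡ sum as !
decHead-factorial []           _        = refl
decHead-factorial (suc a ∷ as) _        = refl
decHead-factorial (zero ∷ as)  (() ∷ _)

fromℚᵘ-homo-* : ∀ x y → fromℚᵘ x ℚ.* fromℚᵘ y ≡ fromℚᵘ (x ℚᵘ.* y)
fromℚᵘ-homo-* x y = begin
  fromℚᵘ x ℚ.* fromℚᵘ y                          ≡⟨ ℚ.fromℚᵘ-toℚᵘ _ ⟨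
  fromℚᵘ (toℚᵘ (fromℚᵘ x ℚ.* fromℚᵘ y))          ≡⟨ ℚ.fromℚᵘ-cong (ℚ.toℚᵘ-homo-* (fromℚᵘ x) (fromℚᵘ y)) ⟩
  fromℚᵘ (toℚᵘ (fromℚᵘ x) ℚᵘ.* toℚᵘ (fromℚᵘ y))  ≡⟨ ℚ.fromℚᵘ-cong (ℚᵘ.*-cong (ℚ.toℚᵘ-fromℚᵘ x) (ℚ.toℚᵘ-fromℚᵘ y)) ⟩
  fromℚᵘ (x ℚᵘ.* y)                              ∎
  where open ≡-Reasoning

fromℚᵘ-homo-+ : ∀ x y → fromℚᵘ x ℚ.+ fromℚᵘ y ≡ fromℚᵘ (x ℚᵘ.+ y)
fromℚᵘ-homo-+ x y = begin
  fromℚᵘ x ℚ.+ fromℚᵘ y                          ≡⟨ ℚ.fromℚᵘ-toℚᵘ _ ⟨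
  fromℚᵘ (toℚᵘ (fromℚᵘ x ℚ.+ fromℚᵘ y))          ≡⟨ ℚ.fromℚᵘ-cong (ℚ.toℚᵘ-homo-+ (fromℚᵘ x) (fromℚᵘ y)) ⟩
  fromℚᵘ (toℚᵘ (fromℚᵘ x) ℚᵘ.+ toℚᵘ (fromℚᵘ y))  ≡⟨ ℚ.fromℚᵘ-cong (ℚᵘ.+-cong (ℚ.toℚᵘ-fromℚᵘ x) (ℚ.toℚᵘ-fromℚᵘ y)) ⟩
  fromℚᵘ (x ℚᵘ.+ y)                              ∎
  where open ≡-Reasoning

/-cross : ∀ a b c d .{{_ : NonZero b}} .{{_ : NonZero d}} → a * d ≡ c * b → + a / b ≡ + c / d
/-cross a (suc b) c (suc d) ad≡cb = ℚ.fromℚᵘ-cong {mkℚᵘ (+ a) b} {mkℚᵘ (+ c) d} (*≡* (begin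
  + a ℤ.* + suc d   ≡⟨ ℤ.pos-* a (suc d) ⟨
  + (a * suc d)     ≡⟨ cong +_ ad≡cb ⟩
  + (c * suc b)     ≡⟨ ℤ.pos-* c (suc b) ⟩
  + c ℤ.* + suc b   ∎))
  where open ≡-Reasoning

/-* : ∀ a b c d .{{_ : NonZero b}} .{{_ : NonZero d}} →
  (+ a / b) ℚ.* (+ c / d) ≡ (+ (a * c) / (b * d)) {{ℕ.m*n≢0 b d}}
/-* a (suc b) c (suc d) = trans (fromℚᵘ-homo-* (mkℚᵘ (+ a) b) (mkℚᵘ (+ c) d))
                                (cong (λ z → z / (suc b * suc d)) (sym (ℤ.pos-* a c)))

/-+ : ∀ a c d .{{_ : NonZero d}} → (+ a / d) ℚ.+ (+ c / d) ≡ + (a + c) / d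
/-+ a c (suc d) = trans (fromℚᵘ-homo-+ (mkℚᵘ (+ a) d) (mkℚᵘ (+ c) d)) (ℚ.fromℚᵘ-cong same-value)
  where
  open ≡-Reasoning
  D = + suc d
  distrib : ∀ x y z → (x ℤ.* z ℤ.+ y ℤ.* z) ℤ.* z ≡ (x ℤ.+ y) ℤ.* (z ℤ.* z)
  distrib = solveℤ
  same-value : mkℚᵘ (+ a) d ℚᵘ.+ mkℚᵘ (+ c) d ℚᵘ.≃ mkℚᵘ (+ (a + c)) d
  same-value = *≡* (begin
    (+ a ℤ.* D ℤ.+ + c ℤ.* D) ℤ.* D     ≡⟨ distrib (+ a) (+ c) D ⟩
    (+ a ℤ.+ + c) ℤ.* (D ℤ.* D)         ≡⟨ cong₂ ℤ._*_ (ℤ.pos-+ a c) (ℤ.pos-* (suc d) (suc d)) ⟨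
    + (a + c) ℤ.* + (suc d * suc d)     ∎)

sumℚ-fractions : ∀ m (h : ℕ → ℚ) (g : ℕ → ℕ) D .{{_ : NonZero D}} →
  (∀ k → k < m → h k ≡ + g k / D) → sumℚ (applyUpTo h m) ≡ + ∑< m g / D
sumℚ-fractions zero    h g D _   = sym (ℚ.0/n≡0 D)
sumℚ-fractions (suc m) h g D h≡ = begin
  h 0 ℚ.+ sumℚ (applyUpTo (h ∘ suc) m)
    ≡⟨ cong₂ ℚ._+_ (h≡ 0 (s≤s z≤n)) (sumℚ-fractions m (h ∘ suc) (g ∘ suc) D (λ k k<m → h≡ (suc k) (s≤s k<m))) ⟩
  (+ g 0 / D) ℚ.+ (+ ∑< m (g ∘ suc) / D)    ≡⟨ /-+ (g 0) _ D ⟩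
  + ∑< (suc m) g / D                         ∎
  where open ≡-Reasoning

theorem3 : (is : List ℕ) → is ≢ [] → All (λ i → 0 < i) is →
    Ω′ is ≡ ((+ 1) / (2 * suc (sum is))) ℚ.*
      sumℚ (map (λ k → Ω′ (decLast (take k is)) ℚ.* Ω′ (decHead (drop k is)))
                (upTo (suc (length is))))
theorem3 is is≢[] is>0 = sym (begin
  half ℚ.* sumℚ (map term (upTo (suc n)))       ≡⟨ cong (λ xs → half ℚ.* sumℚ xs) (List.map-applyUpTo id term (suc n)) ⟩
  half ℚ.* sumℚ (applyUpTo term (suc n))        ≡⟨ cong (half ℚ.*_) (sumℚ-fractions (suc n) term weighted (N !) term-as-fraction) ⟩
  half ℚ.* (+ ∑< (suc n) weighted / N !)        ≡⟨ cong (λ x → half ℚ.* (+ x / N !)) (twice-Ω is is≢[] is>0) ⟨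
  half ℚ.* (+ (2 * Ω is) / N !)                 ≡⟨ /-* 1 (2 * suc N) (2 * Ω is) (N !) ⟩
  + (1 * (2 * Ω is)) / (2 * suc N * N !)
    ≡⟨ /-cross (1 * (2 * Ω is)) (2 * suc N * N !) (Ω is) (suc N !) {{2[N+1]N!≢0}} {{suc N !≢0}} (cancel-2 (Ω is) (suc N) (N !)) ⟩
  Ω′ is                                         ∎)
  where
  open ≡-Reasoning
  N = sum is
  n = length is
  instance
    N!≢0 : NonZero (N !)
    N!≢0 = N !≢0
    2[N+1]N!≢0 : NonZero (2 * suc N * N !)
    2[N+1]N!≢0 = ℕ.m*n≢0 (2 * suc N) (N !)
  half = + 1 / (2 * suc N)
  term : ℕ → ℚ
  term k = Ω′ (decLast (take k is)) ℚ.* Ω′ (decHead (drop k is))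
  weighted : ℕ → ℕ
  weighted k = (N C sum (take k is)) * (Ω (decLast (take k is)) * Ω (decHead (drop k is)))
  cancel-2 : ∀ x y z → 1 * (2 * x) * (y * z) ≡ x * (2 * y * z)
  cancel-2 = solve-∀
  term-as-fraction : ∀ k → k < suc n → term k ≡ + weighted k / N !
  term-as-fraction k _ = trans (/-* (Ω A) DA (Ω B) DB {{suc (sum A) !≢0}} {{suc (sum B) !≢0}})
                               (/-cross (Ω A * Ω B) (DA * DB) (weighted k) (N !) {{ℕ.m*n≢0 DA DB {{suc (sum A) !≢0}} {{suc (sum B) !≢0}}}} cross)
    where
    A = decLast (take k is)
    B = decHead (drop k is)
    DA = suc (sum A) !
    DB = suc (sum B) !
    t = sum (take k is)
    s = sum (drop k is)
    regroup : ∀ x c f → x * (c * f) ≡ c * x * f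
    regroup = solve-∀
    N≡t+s : N ≡ t + s
    N≡t+s = trans (cong sum (sym (List.take++drop≡id k is))) (sum-++ (take k is) (drop k is))
    cross : Ω A * Ω B * N ! ≡ weighted k * (DA * DB)
    cross = begin
      Ω A * Ω B * N !                            ≡⟨ cong (λ m → Ω A * Ω B * m !) N≡t+s ⟩
      Ω A * Ω B * (t + s) !                      ≡⟨ cong (Ω A * Ω B *_) (binomial-factorials t s) ⟨
      Ω A * Ω B * (((t + s) C t) * (t ! * s !))  ≡⟨ regroup (Ω A * Ω B) ((t + s) C t) (t ! * s !) ⟩
      ((t + s) C t) * (Ω A * Ω B) * (t ! * s !)  ≡⟨ cong₂ (λ m f → (m C t) * (Ω A * Ω B) * f) N≡t+s
                                                          (cong₂ _*_ (decLast-factorial (take k is) (All.take⁺ k is>0))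
                                                                     (decHead-factorial (drop k is) (All.drop⁺ k is>0))) ⟨
      weighted k * (DA * DB)                     ∎
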